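{- Let $(T_n)_{n\ge 0}$ be the Tribonacci sequence. The Diophantine equation $$(T_{n}+1)(T_{n+1}+1)\cdots (T_{n+\ell-1}+1)=d\left(\frac{10^{m}-1}{9}\right)$$ has no solution in positive integers $n,\ell,m,d$ with $1\leq d\leq 9$ and $m\geq 2$.
   Context: The Tribonacci sequence is defined by $T_0=0$, $T_1=T_2=1$ and $T_{n+3}=T_{n+2}+T_{n+1}+T_n$ for all $n\ge 0$. The right-hand side $d(10^m-1)/9$ is the repdigit consisting of $m$ copies of the digit $d$. -}

module Defs where

open import Data.Nat using (ℕ; zero; suc; _+_; _*_)

T : ℕ → ℕ
T 0 = 0
T 1 = 1
T 2 = 1
T (suc (suc (suc n))) = T (suc (suc n)) + T (suc n) + T n

prodShift : ℕ → ℕ → ℕ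
prodShift n zero = 1
prodShift n (suc ℓ) = (T n + 1) * prodShift (suc n) ℓ

-- All residues are taken modulo M = 2⁵·3·7·13·17·41·53·79, modulo which the Tribonacci
-- sequence has period 87360, so the residue of the product depends only on ℓ and n mod 87360.
-- Write R m for the repunit, so that the right-hand side is d · R m. For m ≥ 2, R m is odd,
-- hence invertible modulo 32, so the residue of d · R m modulo 32 determines the digit d; in
-- particular 16 ∤ d · R m. Every product of eight consecutive factors T k + 1 turns out to be
-- divisible by 16, which forces ℓ < 8. For ℓ < 8 the residue of the product then fixes d; for
-- m ≤ 4 the residue modulo M rules out d · R m directly, and for m ≥ 5 one of the moduli 41,
-- 53·79, 3·7·13·17, modulo which R m is periodic in m with period 5, 13, 48, rules out every m
-- at once. Both facts are checked by evaluation over one period.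
module Submission where

open import Defs
open import Data.Nat using (ℕ; _*_; _∸_; _^_; _/_; _≤_)
open import Relation.Binary.PropositionalEquality using (_≡_)
open import Relation.Nullary using (¬_)

open import Data.Bool.Base using (Bool; true; _∧_; _∨_; not; if_then_else_) renaming (T to IsTrue)
open import Data.Bool.Properties using (T-∧; T-∨; T-≡)
open import Data.Nat.Base using (zero; suc; _+_; _%_; _<_; _≡ᵇ_; _<ᵇ_; NonZero; z≤n; s≤s; s<s)
open import Data.Nat.Properties
  using (+-suc; +-identityʳ; +-comm; +-assoc; *-assoc; *-identityˡ; *-identityʳ; m+n∸n≡m; m+[n∸m]≡n;
         ≡ᵇ⇒≡; ≡⇒≡ᵇ; <ᵇ⇒<; <⇒<ᵇ; _<?_; ≮⇒≥; ≤⇒≯; ≤-refl; <-≤-trans; m≤m+n;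
         m<n⇒n≢0; m<n⇒m<1+n)
open import Data.Nat.DivMod
  using (m≡m%n+[m/n]*n; m%n%n≡m%n; m%n<n; m<n⇒m%n≡m; %-distribˡ-+; %-distribˡ-*; %-remove-+ʳ;
         m*n/n≡m; m∣n⇒o%n%m≡o%m)
open import Data.Nat.Divisibility using (_∣_; divides; ∣m⇒∣m*n; ∣n⇒∣m*n; n∣m⇒m%n≡0; m%n≡0⇒n∣m)
open import Data.Nat.GeneralisedArithmetic using (iterate)
open import Data.Nat.Tactic.RingSolver using (solve-∀)
open import Data.Product using (_×_; _,_; proj₁; proj₂)
open import Data.Sum using ([_,_])
open import Function.Base using (_∘_)
open import Function.Bundles using (Equivalence)
open import Function.Strict using (_$!′_; force-≡)
open import Relation.Binary.PropositionalEquality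
  using (refl; sym; trans; cong; cong₂; subst; module ≡-Reasoning)
open import Relation.Nullary using (yes; no)

open ≡-Reasoning

private
  ∧-elimˡ : ∀ {x y} → IsTrue (x ∧ y) → IsTrue x
  ∧-elimˡ = proj₁ ∘ Equivalence.to T-∧

  ∧-elimʳ : ∀ {x y} → IsTrue (x ∧ y) → IsTrue y
  ∧-elimʳ = proj₂ ∘ Equivalence.to T-∧

  ∨-refute : ∀ {x y} → ¬ IsTrue x → ¬ IsTrue y → ¬ IsTrue (x ∨ y)
  ∨-refute ¬x ¬y = [ ¬x , ¬y ] ∘ Equivalence.to T-∨

  not-refute : ∀ {x} → IsTrue x → ¬ IsTrue (not x)
  not-refute {true} _ ()

-- Strict in the orbit, so that evaluating a long orbit does not build up a chain of thunks.
allOnOrbit : {A : Set} → (A → Bool) → (A → A) → ℕ → A → Bool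
allOnOrbit p f zero    x = true
allOnOrbit p f (suc k) x = p x ∧ (allOnOrbit p f k $!′ f x)

module Trajectory {A : Set} (f : A → A) (g : ℕ → A) (g-step : ∀ n → f (g n) ≡ g (suc n)) where

  iterate-g : ∀ k n → iterate f (g n) k ≡ g (k + n)
  iterate-g zero    n = refl
  iterate-g (suc k) n = begin
    iterate f (f (g n)) k    ≡⟨ cong (λ x → iterate f x k) (g-step n) ⟩
    iterate f (g (suc n)) k  ≡⟨ iterate-g k (suc n) ⟩
    g (k + suc n)            ≡⟨ cong g (+-suc k n) ⟩
    g (suc k + n)            ∎

  g-periodic : ∀ m → iterate f (g 0) m ≡ g 0 → ∀ n → g (n + m) ≡ g n
  g-periodic m fᵐ[g0]≡g0 n = begin
    g (n + m)          ≡⟨ iterate-g n m ⟨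
    iterate f (g m) n  ≡⟨ cong (λ x → iterate f x n) g[m]≡g[0] ⟩
    iterate f (g 0) n  ≡⟨ iterate-g n 0 ⟩
    g (n + 0)          ≡⟨ cong g (+-identityʳ n) ⟩
    g n                ∎
    where
    g[m]≡g[0] : g m ≡ g 0
    g[m]≡g[0] = trans (cong g (sym (+-identityʳ m))) (trans (sym (iterate-g m 0)) fᵐ[g0]≡g0)

  allOnOrbit-sound : ∀ (p : A → Bool) {k} → IsTrue (allOnOrbit p f k (g 0)) →
                     ∀ {j} → j < k → IsTrue (p (g j))
  allOnOrbit-sound p h {j} j<k = subst (IsTrue ∘ p ∘ g) (+-identityʳ j) (from _ 0 h j<k)
    where
    from : ∀ k n → IsTrue (allOnOrbit p f k (g n)) → ∀ {j} → j < k → IsTrue (p (g (j + n)))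
    from (suc k) n h {zero}  _         = ∧-elimˡ h
    from (suc k) n h {suc j} (s<s j<k) = subst (IsTrue ∘ p ∘ g) (+-suc j n) (from k (suc n) rest j<k)
      where
      rest : IsTrue (allOnOrbit p f k (g (suc n)))
      rest = subst IsTrue (trans (force-≡ (f (g n)) (allOnOrbit p f k)) (cong (allOnOrbit p f k) (g-step n)))
                   (∧-elimʳ h)

periodic⇒f[m]≡f[m%p] : ∀ {A : Set} (f : ℕ → A) p .{{_ : NonZero p}} →
                       (∀ m → f (m + p) ≡ f m) → ∀ m → f m ≡ f (m % p)
periodic⇒f[m]≡f[m%p] f p f-periodic m = begin
  f m                    ≡⟨ cong f (m≡m%n+[m/n]*n m p) ⟩
  f (m % p + m / p * p)  ≡⟨ drop (m / p) ⟩
  f (m % p)              ∎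
  where
  drop : ∀ q → f (m % p + q * p) ≡ f (m % p)
  drop zero    = cong f (+-identityʳ (m % p))
  drop (suc q) = begin
    f (m % p + (p + q * p))  ≡⟨ cong f (trans (cong (m % p +_) (+-comm p (q * p)))
                                              (sym (+-assoc (m % p) (q * p) p))) ⟩
    f (m % p + q * p + p)    ≡⟨ f-periodic (m % p + q * p) ⟩
    f (m % p + q * p)        ≡⟨ drop q ⟩
    f (m % p)                ∎

%-cong-+ : ∀ {a a′ b b′} q .{{_ : NonZero q}} →
           a % q ≡ a′ % q → b % q ≡ b′ % q → (a + b) % q ≡ (a′ + b′) % q
%-cong-+ {a} {a′} {b} {b′} q ha hb = begin
  (a + b) % q            ≡⟨ %-distribˡ-+ a b q ⟩
  (a % q + b % q) % q    ≡⟨ cong₂ (λ x y → (x + y) % q) ha hb ⟩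
  (a′ % q + b′ % q) % q  ≡⟨ %-distribˡ-+ a′ b′ q ⟨
  (a′ + b′) % q          ∎

%-cong-* : ∀ {a a′ b b′} q .{{_ : NonZero q}} →
           a % q ≡ a′ % q → b % q ≡ b′ % q → (a * b) % q ≡ (a′ * b′) % q
%-cong-* {a} {a′} {b} {b′} q ha hb = begin
  (a * b) % q              ≡⟨ %-distribˡ-* a b q ⟩
  (a % q * (b % q)) % q    ≡⟨ cong₂ (λ x y → (x * y) % q) ha hb ⟩
  (a′ % q * (b′ % q)) % q  ≡⟨ %-distribˡ-* a′ b′ q ⟨
  (a′ * b′) % q            ∎

%-cong-+ˡ : ∀ {a a′} b q .{{_ : NonZero q}} → a % q ≡ a′ % q → (a + b) % q ≡ (a′ + b) % q
%-cong-+ˡ b q ha = %-cong-+ {b = b} q ha refl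

%-cong-*ʳ : ∀ a {b b′} q .{{_ : NonZero q}} → b % q ≡ b′ % q → (a * b) % q ≡ (a * b′) % q
%-cong-*ʳ a q = %-cong-* {a} q refl

d≤9⇒d<10+n : ∀ {d} n → d ≤ 9 → d < 10 + n
d≤9⇒d<10+n n d≤9 = <-≤-trans (s≤s d≤9) (m≤m+n 10 n)

repunit : ℕ → ℕ
repunit zero    = 0
repunit (suc m) = 10 * repunit m + 1

10^m≡repunit[m]*9+1 : ∀ m → 10 ^ m ≡ repunit m * 9 + 1
10^m≡repunit[m]*9+1 zero    = refl
10^m≡repunit[m]*9+1 (suc m) = begin
  10 * 10 ^ m                   ≡⟨ cong (10 *_) (10^m≡repunit[m]*9+1 m) ⟩
  10 * (repunit m * 9 + 1)      ≡⟨ identity (repunit m) ⟩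
  (10 * repunit m + 1) * 9 + 1  ∎
  where
  identity : ∀ x → 10 * (x * 9 + 1) ≡ (10 * x + 1) * 9 + 1
  identity = solve-∀

[10^m∸1]/9≡repunit[m] : ∀ m → (10 ^ m ∸ 1) / 9 ≡ repunit m
[10^m∸1]/9≡repunit[m] m = begin
  (10 ^ m ∸ 1) / 9             ≡⟨ cong (λ x → (x ∸ 1) / 9) (10^m≡repunit[m]*9+1 m) ⟩
  (repunit m * 9 + 1 ∸ 1) / 9  ≡⟨ cong (_/ 9) (m+n∸n≡m (repunit m * 9) 1) ⟩
  repunit m * 9 / 9            ≡⟨ m*n/n≡m (repunit m) 9 ⟩
  repunit m                    ∎

repunit-+ : ∀ m p → repunit (m + p) ≡ repunit m + repunit p * 10 ^ m
repunit-+ zero    p = sym (*-identityʳ (repunit p))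
repunit-+ (suc m) p = begin
  10 * repunit (m + p) + 1                        ≡⟨ cong (λ x → 10 * x + 1) (repunit-+ m p) ⟩
  10 * (repunit m + repunit p * 10 ^ m) + 1       ≡⟨ identity (repunit m) (repunit p) (10 ^ m) ⟩
  10 * repunit m + 1 + repunit p * (10 * 10 ^ m)  ∎
  where
  identity : ∀ x y z → 10 * (x + y * z) + 1 ≡ 10 * x + 1 + y * (10 * z)
  identity = solve-∀

repunit-periodic : ∀ q .{{_ : NonZero q}} p .{{_ : NonZero p}} → q ∣ repunit p →
                   ∀ m → repunit m % q ≡ repunit (m % p) % q
repunit-periodic q p q∣Rp = periodic⇒f[m]≡f[m%p] (λ m → repunit m % q) p shift
  where
  shift : ∀ m → repunit (m + p) % q ≡ repunit m % q
  shift m = trans (cong (_% q) (repunit-+ m p)) (%-remove-+ʳ (repunit m) (∣m⇒∣m*n (10 ^ m) q∣Rp))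

repunitStep : ∀ q .{{_ : NonZero q}} → ℕ → ℕ
repunitStep q r = (10 * r + 1) % q

repunitStep-% : ∀ q .{{_ : NonZero q}} m → repunitStep q (repunit m % q) ≡ repunit (suc m) % q
repunitStep-% q m = %-cong-+ˡ 1 q (%-cong-*ʳ 10 q (m%n%n≡m%n (repunit m) q))

repunit[5+k]%32≡7 : ∀ k → repunit (5 + k) % 32 ≡ 7
repunit[5+k]%32≡7 zero    = refl
repunit[5+k]%32≡7 (suc k) = begin
  repunit (suc (5 + k)) % 32             ≡⟨ repunitStep-% 32 (5 + k) ⟨
  repunitStep 32 (repunit (5 + k) % 32)  ≡⟨ cong (repunitStep 32) (repunit[5+k]%32≡7 k) ⟩
  7                                      ∎

-- An inverse of repunit m modulo 32 for m ≥ 2, as repunit m ≡ 11, 15, 23, 7, 7, … (mod 32).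
repunit⁻¹ : ℕ → ℕ
repunit⁻¹ 2 = 3
repunit⁻¹ 3 = 15
repunit⁻¹ 4 = 7
repunit⁻¹ _ = 23

repunit⁻¹-inverse : ∀ {m} → 2 ≤ m → repunit⁻¹ m * repunit m % 32 ≡ 1
repunit⁻¹-inverse {1} (s≤s ())
repunit⁻¹-inverse {2} _ = refl
repunit⁻¹-inverse {3} _ = refl
repunit⁻¹-inverse {4} _ = refl
repunit⁻¹-inverse {suc (suc (suc (suc (suc k))))} _ =
  trans (%-distribˡ-* 23 (repunit (5 + k)) 32) (cong (λ r → 23 * r % 32) (repunit[5+k]%32≡7 k))

recoverDigit : ℕ → ℕ → ℕ
recoverDigit m v = repunit⁻¹ m * v % 32

recoverDigit-correct : ∀ {m d v} → 2 ≤ m → d < 32 → v % 32 ≡ d * repunit m % 32 →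
                       recoverDigit m v ≡ d
recoverDigit-correct {m} {d} {v} 2≤m d<32 v≡dR = begin
  repunit⁻¹ m * v % 32                ≡⟨ %-cong-*ʳ (repunit⁻¹ m) 32 v≡dR ⟩
  repunit⁻¹ m * (d * repunit m) % 32  ≡⟨ cong (_% 32) (swap (repunit⁻¹ m) d (repunit m)) ⟩
  d * (repunit⁻¹ m * repunit m) % 32  ≡⟨ %-cong-*ʳ d 32 (repunit⁻¹-inverse 2≤m) ⟩
  d * 1 % 32                          ≡⟨ cong (_% 32) (*-identityʳ d) ⟩
  d % 32                              ≡⟨ m<n⇒m%n≡m d<32 ⟩
  d                                   ∎
  where
  swap : ∀ x y z → x * (y * z) ≡ y * (x * z)
  swap = solve-∀

data Repdigit : ℕ → Set where
  repdigit : ∀ d m → 1 ≤ d → d ≤ 9 → 2 ≤ m → Repdigit (d * repunit m)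

16∤repdigit : ∀ {x} → 16 ∣ x → ¬ Repdigit x
16∤repdigit 16∣x (repdigit d m 1≤d d≤9 2≤m) = m<n⇒n≢0 1≤d d≡0
  where
  x i : ℕ
  x = d * repunit m
  i = repunit⁻¹ m
  d%16≡0 : d % 16 ≡ 0
  d%16≡0 = begin
    d % 16                 ≡⟨ cong (_% 16) (recoverDigit-correct 2≤m (d≤9⇒d<10+n 22 d≤9) refl) ⟨
    recoverDigit m x % 16  ≡⟨ m∣n⇒o%n%m≡o%m 16 32 (i * x) (divides 2 refl) ⟩
    i * x % 16             ≡⟨ n∣m⇒m%n≡0 (i * x) 16 (∣n⇒∣m*n i 16∣x) ⟩
    0                      ∎
  d≡0 : d ≡ 0
  d≡0 = trans (sym (m<n⇒m%n≡m (d≤9⇒d<10+n 6 d≤9))) d%16≡0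

M : ℕ
M = 25494609504

x%M%q≡x%q : ∀ q .{{_ : NonZero q}} → M % q ≡ 0 → ∀ x → x % M % q ≡ x % q
x%M%q≡x%q q M%q≡0 x = m∣n⇒o%n%m≡o%m q M x (m%n≡0⇒n∣m M q M%q≡0)

notDigit : ℕ → Bool
notDigit d = (d ≡ᵇ 0) ∨ (9 <ᵇ d)

notDigit-refute : ∀ {d} → 1 ≤ d → d ≤ 9 → ¬ IsTrue (notDigit d)
notDigit-refute {d} 1≤d d≤9 = ∨-refute (m<n⇒n≢0 1≤d ∘ ≡ᵇ⇒≡ d 0) (≤⇒≯ d≤9 ∘ <ᵇ⇒< 9 d)

avoids : ∀ q .{{_ : NonZero q}} → ℕ → ℕ → ℕ → Bool
avoids q p d v = allOnOrbit (λ r → not (v % q ≡ᵇ d * r % q)) (repunitStep q) p (repunit 0 % q)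

avoids-refute : ∀ q .{{_ : NonZero q}} p .{{_ : NonZero p}} → q ∣ repunit p →
                ∀ {d v} m → v % q ≡ d * repunit m % q → ¬ IsTrue (avoids q p d v)
avoids-refute q p q∣Rp {d} {v} m v≡dR h =
  not-refute (≡⇒≡ᵇ _ _ v≡dR′)
    (Trajectory.allOnOrbit-sound (repunitStep q) (λ j → repunit j % q) (repunitStep-% q)
       (λ r → not (v % q ≡ᵇ d * r % q)) h (m%n<n m p))
  where
  v≡dR′ : v % q ≡ d * (repunit (m % p) % q) % q
  v≡dR′ = begin
    v % q                          ≡⟨ v≡dR ⟩
    d * repunit m % q              ≡⟨ %-cong-*ʳ d q (repunit-periodic q p q∣Rp m) ⟩
    d * repunit (m % p) % q        ≡⟨ %-cong-*ʳ d q (m%n%n≡m%n (repunit (m % p)) q) ⟨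
    d * (repunit (m % p) % q) % q  ∎

notRepdigitOfLength : ℕ → ℕ → Bool
notRepdigitOfLength m v = notDigit d ∨ not (v ≡ᵇ d * repunit m % M)
  where
  d : ℕ
  d = recoverDigit m v

notLongRepdigit : ℕ → Bool
notLongRepdigit v = notDigit d ∨ avoids 41 5 d v ∨ avoids (53 * 79) 13 d v ∨ avoids (3 * 7 * 13 * 17) 48 d v
  where
  d : ℕ
  d = recoverDigit 5 v

sieve : ℕ → Bool
sieve v = notRepdigitOfLength 2 v ∧ notRepdigitOfLength 3 v ∧ notRepdigitOfLength 4 v ∧ notLongRepdigit v

recoverDigit-repdigit : ∀ {d m} → 1 ≤ d → d ≤ 9 → 2 ≤ m → recoverDigit m (d * repunit m % M) ≡ d
recoverDigit-repdigit {d} {m} 1≤d d≤9 2≤m =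
  recoverDigit-correct 2≤m (d≤9⇒d<10+n 22 d≤9) (x%M%q≡x%q 32 refl (d * repunit m))

notRepdigitOfLength-refute : ∀ {d m} → 1 ≤ d → d ≤ 9 → 2 ≤ m →
                             ¬ IsTrue (notRepdigitOfLength m (d * repunit m % M))
notRepdigitOfLength-refute {d} {m} 1≤d d≤9 2≤m h =
  ∨-refute (notDigit-refute 1≤d d≤9) (not-refute (≡⇒≡ᵇ v v refl))
    (subst (λ e → IsTrue (notDigit e ∨ not (v ≡ᵇ e * repunit m % M))) (recoverDigit-repdigit 1≤d d≤9 2≤m) h)
  where
  v : ℕ
  v = d * repunit m % M

notLongRepdigit-refute : ∀ {d} k → 1 ≤ d → d ≤ 9 → ¬ IsTrue (notLongRepdigit (d * repunit (5 + k) % M))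
notLongRepdigit-refute {d} k 1≤d d≤9 h =
  ∨-refute (notDigit-refute 1≤d d≤9)
    (∨-refute (excluded 41 5 refl refl)
      (∨-refute (excluded (53 * 79) 13 refl refl) (excluded (3 * 7 * 13 * 17) 48 refl refl)))
    (subst (λ e → IsTrue (notDigit e ∨ avoids 41 5 e v ∨ avoids (53 * 79) 13 e v ∨ avoids (3 * 7 * 13 * 17) 48 e v))
           (recoverDigit-repdigit {m = m} 1≤d d≤9 (s≤s (s≤s z≤n))) h)
  where
  m v : ℕ
  m = 5 + k
  v = d * repunit m % M
  excluded : ∀ q .{{_ : NonZero q}} p .{{_ : NonZero p}} → repunit p % q ≡ 0 → M % q ≡ 0 →
             ¬ IsTrue (avoids q p d v)
  excluded q p Rp%q≡0 M%q≡0 =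
    avoids-refute q p (m%n≡0⇒n∣m _ q Rp%q≡0) {d} m (x%M%q≡x%q q M%q≡0 (d * repunit m))

sieve-sound : ∀ {x} → IsTrue (sieve (x % M)) → ¬ Repdigit x
sieve-sound h (repdigit d 1 _ _ (s≤s ()))
sieve-sound h (repdigit d 2 1≤d d≤9 2≤m) = notRepdigitOfLength-refute 1≤d d≤9 2≤m (∧-elimˡ h)
sieve-sound {x} h (repdigit d 3 1≤d d≤9 2≤m) =
  notRepdigitOfLength-refute 1≤d d≤9 2≤m (∧-elimˡ (∧-elimʳ {notRepdigitOfLength 2 (x % M)} h))
sieve-sound {x} h (repdigit d 4 1≤d d≤9 2≤m) =
  notRepdigitOfLength-refute 1≤d d≤9 2≤m
    (∧-elimˡ (∧-elimʳ {notRepdigitOfLength 3 (x % M)} (∧-elimʳ {notRepdigitOfLength 2 (x % M)} h)))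
sieve-sound {x} h (repdigit d (suc (suc (suc (suc (suc k))))) 1≤d d≤9 _) =
  notLongRepdigit-refute k 1≤d d≤9
    (∧-elimʳ {notRepdigitOfLength 4 (x % M)}
      (∧-elimʳ {notRepdigitOfLength 3 (x % M)} (∧-elimʳ {notRepdigitOfLength 2 (x % M)} h)))

prodShift-+ : ∀ ℓ k n → prodShift n (ℓ + k) ≡ prodShift n ℓ * prodShift (ℓ + n) k
prodShift-+ zero    k n = sym (*-identityˡ (prodShift n k))
prodShift-+ (suc ℓ) k n = begin
  (T n + 1) * prodShift (suc n) (ℓ + k)                        ≡⟨ cong ((T n + 1) *_) (prodShift-+ ℓ k (suc n)) ⟩
  (T n + 1) * (prodShift (suc n) ℓ * prodShift (ℓ + suc n) k)  ≡⟨ *-assoc (T n + 1) _ _ ⟨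
  (T n + 1) * prodShift (suc n) ℓ * prodShift (ℓ + suc n) k    ≡⟨ cong (λ i → (T n + 1) * prodShift (suc n) ℓ * prodShift i k)
                                                                       (+-suc ℓ n) ⟩
  (T n + 1) * prodShift (suc n) ℓ * prodShift (suc ℓ + n) k    ∎

prodShift-suc : ∀ ℓ n → prodShift n (suc ℓ) ≡ prodShift n ℓ * (T (ℓ + n) + 1)
prodShift-suc ℓ n = begin
  prodShift n (suc ℓ)                    ≡⟨ cong (prodShift n) (+-comm 1 ℓ) ⟩
  prodShift n (ℓ + 1)                    ≡⟨ prodShift-+ ℓ 1 n ⟩
  prodShift n ℓ * ((T (ℓ + n) + 1) * 1)  ≡⟨ cong (prodShift n ℓ *_) (*-identityʳ (T (ℓ + n) + 1)) ⟩
  prodShift n ℓ * (T (ℓ + n) + 1)        ∎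

module TribonacciResidues (q : ℕ) .{{_ : NonZero q}} where

  Window : Set
  Window = ℕ × ℕ × ℕ

  window : ℕ → Window
  window n = T n % q , T (suc n) % q , T (suc (suc n)) % q

  step : Window → Window
  step (a , b , c) = (λ e → b , c , e) $!′ (a + b + c) % q

  step-window : ∀ n → step (window n) ≡ window (suc n)
  step-window n = begin
    step (window n)                                ≡⟨ force-≡ ((a % q + b % q + c % q) % q) (λ e → b % q , c % q , e) ⟩
    (b % q , c % q , (a % q + b % q + c % q) % q)  ≡⟨ cong (λ e → b % q , c % q , e) sum≡ ⟩
    window (suc n)                                 ∎
    where
    a b c : ℕ
    a = T n
    b = T (suc n)
    c = T (suc (suc n))
    sum≡ : (a % q + b % q + c % q) % q ≡ (c + b + a) % q
    sum≡ = begin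
      (a % q + b % q + c % q) % q  ≡⟨ %-cong-+ q (%-cong-+ q (m%n%n≡m%n a q) (m%n%n≡m%n b q)) (m%n%n≡m%n c q) ⟩
      (a + b + c) % q              ≡⟨ cong (_% q) (reverse a b c) ⟩
      (c + b + a) % q              ∎
      where
      reverse : ∀ x y z → x + y + z ≡ z + y + x
      reverse = solve-∀

  -- (ℓ , product of the first ℓ factors , window after them)
  Prefix : Set
  Prefix = ℕ × ℕ × Window

  extend : Prefix → Prefix
  extend (ℓ , v , w@(a , _ , _)) = (λ u → suc ℓ , u , step w) $!′ v * (a + 1) % q

  prefix : ℕ → ℕ → Prefix
  prefix n ℓ = ℓ , prodShift n ℓ % q , window (ℓ + n)

  extend-prefix : ∀ n ℓ → extend (prefix n ℓ) ≡ prefix n (suc ℓ)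
  extend-prefix n ℓ = trans (force-≡ (P % q * (t % q + 1) % q) (λ u → suc ℓ , u , step (window (ℓ + n))))
                            (cong₂ (λ u w → suc ℓ , u , w) product≡ (step-window (ℓ + n)))
    where
    P t : ℕ
    P = prodShift n ℓ
    t = T (ℓ + n)
    product≡ : P % q * (t % q + 1) % q ≡ prodShift n (suc ℓ) % q
    product≡ = begin
      P % q * (t % q + 1) % q  ≡⟨ %-cong-* q (m%n%n≡m%n P q) (%-cong-+ˡ 1 q (m%n%n≡m%n t q)) ⟩
      P * (t + 1) % q          ≡⟨ cong (_% q) (prodShift-suc ℓ n) ⟨
      prodShift n (suc ℓ) % q  ∎

open TribonacciResidues M

prefixCertified : Prefix → Bool
prefixCertified (ℓ , v , _) = if ℓ <ᵇ 8 then sieve v else v % 16 ≡ᵇ 0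

prefixCertified-sieve : ∀ {ℓ v w} → ℓ < 8 → IsTrue (prefixCertified (ℓ , v , w)) → IsTrue (sieve v)
prefixCertified-sieve {ℓ} {v} ℓ<8 =
  subst (λ b → IsTrue (if b then sieve v else v % 16 ≡ᵇ 0)) (Equivalence.to T-≡ (<⇒<ᵇ ℓ<8))

certified : Window → Bool
certified w = allOnOrbit prefixCertified extend 9 (0 , 1 % M , w)

-- The period and the certificate are parameters so that, while checking these proofs, the type
-- checker never unfolds the closed computations they stand for.
module Certified (p : ℕ) .{{_ : NonZero p}} (p-period : iterate step (window 0) p ≡ window 0)
                 (all-certified : allOnOrbit certified step p (window 0) ≡ true) where

  window-certified : ∀ n → IsTrue (certified (window n))
  window-certified n =
    subst (λ w → IsTrue (certified w)) (sym (periodic⇒f[m]≡f[m%p] window p (g-periodic p p-period) n))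
      (allOnOrbit-sound certified (Equivalence.from T-≡ all-certified) (m%n<n n p))
    where open Trajectory step window step-window

  prefix-certified : ∀ n {ℓ} → ℓ < 9 → IsTrue (prefixCertified (prefix n ℓ))
  prefix-certified n =
    Trajectory.allOnOrbit-sound extend (prefix n) (extend-prefix n) prefixCertified (window-certified n)

  prodShift-sieved : ∀ n {ℓ} → ℓ < 8 → IsTrue (sieve (prodShift n ℓ % M))
  prodShift-sieved n {ℓ} ℓ<8 =
    prefixCertified-sieve {ℓ} {prodShift n ℓ % M} {window (ℓ + n)} ℓ<8 (prefix-certified n (m<n⇒m<1+n ℓ<8))

  16∣prodShift[8] : ∀ n → 16 ∣ prodShift n 8
  16∣prodShift[8] n = m%n≡0⇒n∣m (prodShift n 8) 16 (begin
    prodShift n 8 % 16      ≡⟨ x%M%q≡x%q 16 refl (prodShift n 8) ⟨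
    prodShift n 8 % M % 16  ≡⟨ ≡ᵇ⇒≡ (prodShift n 8 % M % 16) 0 (prefix-certified n ≤-refl) ⟩
    0                       ∎)

  16∣prodShift : ∀ n {ℓ} → 8 ≤ ℓ → 16 ∣ prodShift n ℓ
  16∣prodShift n {ℓ} 8≤ℓ = subst (λ i → 16 ∣ prodShift n i) (m+[n∸m]≡n 8≤ℓ)
    (subst (16 ∣_) (sym (prodShift-+ 8 (ℓ ∸ 8) n))
       (∣m⇒∣m*n (prodShift (8 + n) (ℓ ∸ 8)) (16∣prodShift[8] n)))

  ¬repdigit-prodShift : ∀ n ℓ → ¬ Repdigit (prodShift n ℓ)
  ¬repdigit-prodShift n ℓ with ℓ <? 8
  ... | yes ℓ<8 = sieve-sound (prodShift-sieved n ℓ<8)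
  ... | no  ℓ≮8 = 16∤repdigit (16∣prodShift n (≮⇒≥ ℓ≮8))

period : ℕ
period = 87360

window-period : iterate step (window 0) period ≡ window 0
window-period = refl

all-windows-certified : allOnOrbit certified step period (window 0) ≡ true
all-windows-certified = refl

open Certified period window-period all-windows-certified

theorem1 : ∀ (n ℓ m d : ℕ) → 1 ≤ n → 1 ≤ ℓ → 2 ≤ m → 1 ≤ d → d ≤ 9 →
    ¬ (prodShift n ℓ ≡ d * ((10 ^ m ∸ 1) / 9))
theorem1 n ℓ m d _ _ 2≤m 1≤d d≤9 eq =
  ¬repdigit-prodShift n ℓ (subst Repdigit (sym eq′) (repdigit d m 1≤d d≤9 2≤m))
  where
  eq′ : prodShift n ℓ ≡ d * repunit m
  eq′ = trans eq (cong (d *_) ([10^m∸1]/9≡repunit[m] m))
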